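{- Let $\mathcal{H}_o=(Q_0,Q_1,\mathbb{B}^{\mathrm{oh}})$ be an oriented hypergraph over a field $\mathbb{F}$ such that all hyperedges have the same non-empty source-side vertex set $S=\{v:\mathbb{B}^{\mathrm{oh}}_{v,e}=-1\}$, and the target-side vertex sets $H_i=\{v:\mathbb{B}^{\mathrm{oh}}_{v,e_i}=+1\}$ of the hyperedges $e_1,\dots,e_r$ ($r=|Q_1|$) are pairwise distinct. Then the macrograph of $F(\mathcal{H}_o)$ is a star, and $\delta(F(\mathcal{H}_o))>0$ if and only if the indicator vectors $\mathbf{1}_{H_1},\dots,\mathbf{1}_{H_r}$ are affinely dependent over $\mathbb{F}$. In particular $\delta(F(\mathcal{H}_o))>0$ implies $r\ge4$.
   Context: An oriented hypergraph consists of finite sets $Q_0,Q_1$ and $\mathbb{B}^{\mathrm{oh}}\in\{ -1,0,+1\}^{Q_0\times Q_1}$. $F(\mathcal{H}_o)$ assigns to $e$ the pair $(A_e,B_e)=(\sum_{\mathbb{B}^{\mathrm{oh}}_{v,e}=-1}\mathbf{1}_v,\sum_{\mathbb{B}^{\mathrm{oh}}_{v,e}=+1}\mathbf{1}_v)\in\mathbb{F}^{Q_0}\times\mathbb{F}^{Q_0}$. Its macrograph is the directed multigraph with vertex set $V_{\mathrm{macro}}=\{A_e\}\cup\{B_e\}$ (as a set) and edges $e:A_e\to B_e$; $c_{\mathrm{macro}}$ is its number of weakly connected components; $B_{\mathrm{macro}}(\mathbf{1}_e)=\mathbf{1}_{B_e}-\mathbf{1}_{A_e}\in\mathbb{F}^{V_{\mathrm{macro}}}$;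 $\hat\phi:\mathbb{F}^{V_{\mathrm{macro}}}\to\mathbb{F}^{Q_0}$, $\mathbf{1}_w\mapsto w$; $\delta(F(\mathcal{H}_o))=\dim(\mathrm{Im}B_{\mathrm{macro}}\cap\mathrm{Ker}\hat\phi)$. A star means a graph with one centre vertex joined to all others, which are leaves. Affine dependence of $x_1,\dots,x_r$ means a non-trivial relation $\sum\alpha_ix_i=0$ with $\sum\alpha_i=0$. -}

module Defs where

open import Level using (Level; _⊔_; suc)
open import Data.Nat using (ℕ)
open import Data.Fin using (Fin)
open import Data.Fin.Subset using (Subset; inside; outside)
open import Data.Bool using (Bool; true; false; if_then_else_)
open import Data.Vec using (Vec; tabulate) renaming (lookup to vlookup)
import Data.Vec.Properties as VecP
open import Data.Bool.Properties using () renaming (_≟_ to _≟B_)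
open import Data.List using (List; []; _∷_; concatMap; deduplicate; length; lookup)
open import Data.List using () renaming (allFin to allFinL)
open import Data.Product using (Σ; ∃; _×_; _,_)
open import Data.Sum using (_⊎_)
open import Relation.Nullary using (¬_; Dec; yes; no)
open import Relation.Binary.PropositionalEquality using (_≡_; _≢_)
open import Relation.Binary.Definitions using (DecidableEquality)
open import Algebra.Bundles using (CommutativeRing)

record Field (c ℓ : Level) : Set (suc (c ⊔ ℓ)) where
  field
    commutativeRing : CommutativeRing c ℓ
  open CommutativeRing commutativeRing public
  field
    1≉0     : ¬ (1# ≈ 0#)
    inverse : ∀ x → ¬ (x ≈ 0#) → ∃ λ y → (x * y) ≈ 1#

-- Oriented hypergraphs: Q₀ = Fin n, Q₁ = Fin r, incidence entries in
-- {-1, 0, +1}.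

data Sign : Set where
  minus zer plus : Sign

Incidence : ℕ → ℕ → Set
Incidence n r = Fin n → Fin r → Sign

isMinus : Sign → Bool
isMinus minus = true
isMinus _     = false

isPlus : Sign → Bool
isPlus plus = true
isPlus _    = false

srcSet : ∀ {n r} → Incidence n r → Fin r → Subset n
srcSet 𝔹 e = tabulate (λ v → isMinus (𝔹 v e))

tgtSet : ∀ {n r} → Incidence n r → Fin r → Subset n
tgtSet 𝔹 e = tabulate (λ v → isPlus (𝔹 v e))

_≟S_ : ∀ {n} → DecidableEquality (Subset n)
_≟S_ = VecP.≡-dec _≟B_

-- F(ℋₒ) sends e to (A_e , B_e) = (𝟏_{src e}, 𝟏_{tgt e}).
-- A 0/1-vector in 𝔽^{Q₀} is represented by its support (a Subset n); since
-- 1 ≉ 0 in a field this identification is a bijection, and the map φ̂ below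
-- turns a macro-vertex back into the corresponding vector of 𝔽^{Q₀}.

module Macro {n r : ℕ} (𝔹 : Incidence n r) where

  A B : Fin r → Subset n
  A = srcSet 𝔹
  B = tgtSet 𝔹

  InVmacro : Subset n → Set
  InVmacro w = ∃ λ e → (A e ≡ w) ⊎ (B e ≡ w)

  Incident : Fin r → Subset n → Set
  Incident e w = (A e ≡ w) ⊎ (B e ≡ w)

  IsStar : Set
  IsStar = Σ (Subset n) λ c →
      InVmacro c
    × (∀ e → A e ≢ B e)
    × (∀ e → Incident e c)
    × (∀ w → InVmacro w → w ≢ c →
         ∃ λ e → Incident e w × (∀ e′ → Incident e′ w → e′ ≡ e))

  Vlist : List (Subset n)
  Vlist = deduplicate _≟S_ (concatMap (λ e → A e ∷ B e ∷ []) (allFinL r))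

  m : ℕ
  m = length Vlist

  vtx : Fin m → Subset n
  vtx = lookup Vlist

module Over {c ℓ} (𝔽 : Field c ℓ) where
  open Field 𝔽

  ∑ : ∀ {k} → (Fin k → Carrier) → Carrier
  ∑ {ℕ.zero}  f = 0#
  ∑ {ℕ.suc k} f = f Fin.zero + ∑ (λ i → f (Fin.suc i))

  ⟦_⟧ : Bool → Carrier
  ⟦ b ⟧ = if b then 1# else 0#

  ind : ∀ {p} {P : Set p} → Dec P → Carrier
  ind (yes _) = 1#
  ind (no _)  = 0#

  𝟏 : ∀ {n} → Subset n → Fin n → Carrier
  𝟏 H v = ⟦ vlookup H v ⟧

  AffinelyDependent : ∀ {n r} → (Fin r → Fin n → Carrier) → Set (c ⊔ ℓ)
  AffinelyDependent {n} {r} x = Σ (Fin r → Carrier) λ α →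
      (∃ λ i → ¬ (α i ≈ 0#))
    × (∑ α ≈ 0#)
    × (∀ v → ∑ (λ i → α i * x i v) ≈ 0#)

  module MacroOver {n r : ℕ} (𝔹 : Incidence n r) where
    open Macro 𝔹

    Bmacro : (Fin r → Carrier) → Fin m → Carrier
    Bmacro γ j = ∑ (λ e → γ e * (ind (B e ≟S vtx j) - ind (A e ≟S vtx j)))

    φ̂ : (Fin m → Carrier) → Fin n → Carrier
    φ̂ x v = ∑ (λ j → x j * 𝟏 (vtx j) v)

    -- δ(F(ℋₒ)) = dim (Im B_macro ∩ Ker φ̂) > 0, i.e. this subspace
    -- contains a non-zero vector.
    δ>0 : Set (c ⊔ ℓ)
    δ>0 = Σ (Fin m → Carrier) λ x →
        (∃ λ γ → ∀ j → x j ≈ Bmacro γ j)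
      × (∀ v → φ̂ x v ≈ 0#)
      × (∃ λ j → ¬ (x j ≈ 0#))

-- All hyperedges leave the common source S, and a vertex v₀ ∈ S lies in no target (an
-- incidence entry is not both −1 and +1), so the macrograph is the star with centre S whose
-- leaves are the pairwise distinct targets H_e. Every macro-vertex occurs exactly once in the
-- enumeration of V_macro, hence φ̂ (B_macro γ) = Σ_e γ_e 𝟏_{H_e} − (Σ_e γ_e) 𝟏_S. At v₀ this
-- vanishes only if Σ_e γ_e = 0, so Im B_macro ∩ Ker φ̂ consists of the B_macro γ with γ an
-- affine relation among the 𝟏_{H_e}; and B_macro γ is γ_e at the leaf H_e and −Σ_e γ_e = 0 at
-- the centre, so it is non-zero exactly when γ is.
-- For r ≤ 3, a coordinate separating H₁ from H₂ isolates one of them (its bit there differs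
-- from all others), and the relation read at that coordinate, or at its complement, kills
-- that coefficient; removing it recurses down to r = 1, where Σ_e γ_e = 0 finishes.

module Submission where

open import Defs
open import Level using (Level)
open import Data.Nat using (ℕ; zero; suc; _≤_; _≤?_; s≤s; s≤s⁻¹)
open import Data.Nat.Properties using (≰⇒>; <⇒≤)
open import Data.Fin using (Fin; zero; suc; fromℕ<; punchIn; punchOut; _≟_)
open import Data.Fin.Properties using (0≢1+n; punchIn-injective; punchInᵢ≢i; punchIn-punchOut; ¬∀⟶∃¬)
open import Data.Fin.Subset using (Subset; Nonempty)
open import Data.Bool using (Bool; true; false; not)
open import Data.Bool.Properties using (¬-not; not-injective) renaming (_≟_ to _≟B_)
open import Data.Vec using (Vec) renaming (lookup to vlookup)
open import Data.Vec.Properties using (lookup∘tabulate; []=⇒lookup)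
open import Data.Vec.Relation.Binary.Pointwise.Extensional using (ext; Pointwise-≡⇒≡)
open import Data.Vec.Functional using (removeAt)
open import Data.List using (List; []; _∷_; lookup; length; concatMap) renaming (allFin to allFinL)
open import Data.List.Relation.Unary.Any using (here; there; index; satisfied)
open import Data.List.Relation.Unary.Any.Properties using (lookup-index)
import Data.List.Relation.Unary.All as All
open import Data.List.Relation.Unary.AllPairs using (_∷_)
open import Data.List.Relation.Unary.Unique.Propositional using (Unique)
open import Data.List.Relation.Unary.Unique.DecPropositional.Properties using (deduplicate-!)
open import Data.List.Membership.Propositional using (_∈_; lose)
open import Data.List.Membership.Propositional.Properties
  using (∈-lookup; ∈-allFin; ∈-concatMap⁺; ∈-concatMap⁻; ∈-deduplicate⁺; ∈-deduplicate⁻)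
open import Data.Product using (∃; _×_; _,_; proj₁; proj₂)
open import Data.Sum using (inj₁; inj₂)
open import Data.Empty using (⊥-elim)
open import Function using (_∘_; flip)
open import Function.Bundles using (_⇔_; mk⇔)
open import Function.Definitions using (Injective)
open import Relation.Nullary using (¬_; Dec; yes; no)
open import Relation.Binary.PropositionalEquality as ≡ using (_≡_; _≢_)
import Algebra.Properties.Ring as RingProperties
import Algebra.Properties.Semiring.Sum as SemiringSum

lookup-injective : ∀ {a} {A : Set a} {xs : List A} {i j : Fin (length xs)} →
                   Unique xs → lookup xs i ≡ lookup xs j → i ≡ j
lookup-injective {i = zero}  {zero}  (_    ∷ _) _  = ≡.refl
lookup-injective {i = zero}  {suc j} (x∉xs ∷ _) eq = ⊥-elim (All.lookup x∉xs (∈-lookup j) eq)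
lookup-injective {i = suc i} {zero}  (x∉xs ∷ _) eq = ⊥-elim (All.lookup x∉xs (∈-lookup i) (≡.sym eq))
lookup-injective {i = suc i} {suc j} (_ ∷ xs!) eq = ≡.cong suc (lookup-injective xs! eq)

∀-punchIn : ∀ {p k} {P : Fin (suc k) → Set p} i → P i → (∀ j → P (punchIn i j)) → ∀ j → P j
∀-punchIn {P = P} i Pᵢ P∘punchIn j with i ≟ j
... | yes ≡.refl = Pᵢ
... | no  i≢j    = ≡.subst P (punchIn-punchOut i≢j) (P∘punchIn (punchOut i≢j))

separating-coordinate : ∀ {k} {u w : Vec Bool k} → u ≢ w → ∃ λ v → vlookup u v ≢ vlookup w v
separating-coordinate {k} {u} {w} u≢w =
  ¬∀⟶∃¬ k (λ v → vlookup u v ≡ vlookup w v) (λ v → vlookup u v ≟B vlookup w v)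
        (u≢w ∘ Pointwise-≡⇒≡ ∘ ext)

module FieldFacts {c ℓ} (𝔽 : Field c ℓ) where
  open Field 𝔽 hiding (zero)
  open Over 𝔽 using (∑; ⟦_⟧; ind)
  open RingProperties ring using (-1*x≈-x; -0#≈0#)
  module Sum = SemiringSum semiring
  open import Relation.Binary.Reasoning.Setoid setoid

  ∑≡sum : ∀ {k} (f : Fin k → Carrier) → ∑ f ≡ Sum.sum f
  ∑≡sum {zero}  f = ≡.refl
  ∑≡sum {suc k} f = ≡.cong (f zero +_) (∑≡sum (f ∘ suc))

  ∑-cong : ∀ {k} {f g : Fin k → Carrier} → (∀ i → f i ≈ g i) → ∑ f ≈ ∑ g
  ∑-cong {f = f} {g} f≈g rewrite ∑≡sum f | ∑≡sum g = Sum.sum-cong-≋ f≈g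

  ∑-zero : ∀ {k} {f : Fin k → Carrier} → (∀ i → f i ≈ 0#) → ∑ f ≈ 0#
  ∑-zero {k} {f} f≈0 rewrite ∑≡sum f = trans (Sum.sum-cong-≋ f≈0) (Sum.sum-replicate-zero k)

  ∑-comm : ∀ {k m} (f : Fin k → Fin m → Carrier) → ∑ (λ i → ∑ (f i)) ≈ ∑ (λ j → ∑ (λ i → f i j))
  ∑-comm f = begin
    ∑ (λ i → ∑ (f i))                  ≡⟨ ∑∑≡sumsum f ⟩
    Sum.sum (λ i → Sum.sum (f i))      ≈⟨ Sum.∑-comm f ⟩
    Sum.sum (λ j → Sum.sum (flip f j)) ≡⟨ ≡.sym (∑∑≡sumsum (flip f)) ⟩
    ∑ (λ j → ∑ (flip f j))             ∎
    where
    ∑∑≡sumsum : ∀ {k m} (g : Fin k → Fin m → Carrier) →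
                ∑ (λ i → ∑ (g i)) ≡ Sum.sum (λ i → Sum.sum (g i))
    ∑∑≡sumsum g = ≡.trans (∑≡sum (λ i → ∑ (g i))) (Sum.sum-cong-≗ (λ i → ∑≡sum (g i)))

  ∑-distrib-+ : ∀ {k} (f g : Fin k → Carrier) → ∑ (λ i → f i + g i) ≈ ∑ f + ∑ g
  ∑-distrib-+ f g rewrite ∑≡sum (λ i → f i + g i) | ∑≡sum f | ∑≡sum g = Sum.∑-distrib-+ f g

  *-distribˡ-∑ : ∀ {k} x (f : Fin k → Carrier) → x * ∑ f ≈ ∑ (λ i → x * f i)
  *-distribˡ-∑ x f rewrite ∑≡sum f | ∑≡sum (λ i → x * f i) = Sum.*-distribˡ-sum x f

  *-distribʳ-∑ : ∀ {k} x (f : Fin k → Carrier) → ∑ f * x ≈ ∑ (λ i → f i * x)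
  *-distribʳ-∑ x f rewrite ∑≡sum f | ∑≡sum (λ i → f i * x) = Sum.*-distribʳ-sum x f

  ∑-neg : ∀ {k} (f : Fin k → Carrier) → ∑ (λ i → - f i) ≈ - ∑ f
  ∑-neg f = begin
    ∑ (λ i → - f i)      ≈⟨ ∑-cong (λ i → sym (-1*x≈-x (f i))) ⟩
    ∑ (λ i → - 1# * f i) ≈⟨ sym (*-distribˡ-∑ (- 1#) f) ⟩
    - 1# * ∑ f           ≈⟨ -1*x≈-x (∑ f) ⟩
    - ∑ f                ∎

  ∑-distrib-- : ∀ {k} (f g : Fin k → Carrier) → ∑ (λ i → f i - g i) ≈ ∑ f - ∑ g
  ∑-distrib-- f g = trans (∑-distrib-+ f (λ i → - g i)) (+-congˡ (∑-neg g))

  ∑-remove : ∀ {k} i (f : Fin (suc k) → Carrier) → ∑ f ≈ f i + ∑ (removeAt f i)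
  ∑-remove i f rewrite ∑≡sum f | ∑≡sum (removeAt f i) = Sum.sum-remove f

  ∑-removeAt : ∀ {k} i (f : Fin (suc k) → Carrier) → f i ≈ 0# → ∑ (removeAt f i) ≈ ∑ f
  ∑-removeAt i f fᵢ≈0 = begin
    ∑ (removeAt f i)      ≈⟨ sym (+-identityˡ _) ⟩
    0# + ∑ (removeAt f i) ≈⟨ +-congʳ fᵢ≈0 ⟨
    f i + ∑ (removeAt f i) ≈⟨ ∑-remove i f ⟨
    ∑ f                   ∎

  ∑-delta : ∀ {k} {f : Fin k → Carrier} i → (∀ j → j ≢ i → f j ≈ 0#) → ∑ f ≈ f i
  ∑-delta {suc k} {f} i others≈0 = begin
    ∑ f                    ≈⟨ ∑-remove i f ⟩
    f i + ∑ (removeAt f i) ≈⟨ +-congˡ (∑-zero (λ j → others≈0 (punchIn i j) (punchInᵢ≢i i j))) ⟩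
    f i + 0#               ≈⟨ +-identityʳ (f i) ⟩
    f i                    ∎

  x-0≈x : ∀ x → x - 0# ≈ x
  x-0≈x x = trans (+-congˡ -0#≈0#) (+-identityʳ x)

  ind-yes : ∀ {p} {P : Set p} (P? : Dec P) → P → ind P? ≈ 1#
  ind-yes (yes _) _ = refl
  ind-yes (no ¬P) P = ⊥-elim (¬P P)

  ind-no : ∀ {p} {P : Set p} (P? : Dec P) → ¬ P → ind P? ≈ 0#
  ind-no (yes P) ¬P = ⊥-elim (¬P P)
  ind-no (no _)  _  = refl

  *⟦not⟧ : ∀ x b → x * ⟦ not b ⟧ ≈ x - x * ⟦ b ⟧
  *⟦not⟧ x true  = trans (zeroʳ x) (sym (trans (+-congˡ (-‿cong (*-identityʳ x))) (-‿inverseʳ x)))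
  *⟦not⟧ x false = trans (*-identityʳ x) (sym (trans (+-congˡ (-‿cong (zeroʳ x))) (x-0≈x x)))

isMinus⇒¬isPlus : ∀ s → isMinus s ≡ true → isPlus s ≡ false
isMinus⇒¬isPlus minus _ = ≡.refl

∈srcSet⇒∉tgtSet : ∀ {n r} (𝔹 : Incidence n r) e v →
                  vlookup (srcSet 𝔹 e) v ≡ true → vlookup (tgtSet 𝔹 e) v ≡ false
∈srcSet⇒∉tgtSet 𝔹 e v v∈src = ≡.trans (lookup∘tabulate _ v)
  (isMinus⇒¬isPlus (𝔹 v e) (≡.trans (≡.sym (lookup∘tabulate _ v)) v∈src))

module MacroVertices {n r} (𝔹 : Incidence n r) where
  open Macro 𝔹

  private
    endpoints : Fin r → List (Subset n)
    endpoints e = A e ∷ B e ∷ []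

    allEndpoints : List (Subset n)
    allEndpoints = concatMap endpoints (allFinL r)

  InVmacro⇒∈Vlist : ∀ {w} → InVmacro w → w ∈ Vlist
  InVmacro⇒∈Vlist (e , inj₁ ≡.refl) =
    ∈-deduplicate⁺ _≟S_ (∈-concatMap⁺ endpoints (lose (∈-allFin e) (here ≡.refl)))
  InVmacro⇒∈Vlist (e , inj₂ ≡.refl) =
    ∈-deduplicate⁺ _≟S_ (∈-concatMap⁺ endpoints (lose (∈-allFin e) (there (here ≡.refl))))

  ∈Vlist⇒InVmacro : ∀ {w} → w ∈ Vlist → InVmacro w
  ∈Vlist⇒InVmacro w∈
    with satisfied (∈-concatMap⁻ endpoints {xs = allFinL r} (∈-deduplicate⁻ _≟S_ allEndpoints w∈))
  ... | e , here w≡A         = e , inj₁ (≡.sym w≡A)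
  ... | e , there (here w≡B) = e , inj₂ (≡.sym w≡B)

  vtx-InVmacro : ∀ j → InVmacro (vtx j)
  vtx-InVmacro j = ∈Vlist⇒InVmacro (∈-lookup j)

  vtx-injective : ∀ {i j} → vtx i ≡ vtx j → i ≡ j
  vtx-injective = lookup-injective (deduplicate-! _≟S_ allEndpoints)

module MacroLinear {c ℓ} (𝔽 : Field c ℓ) {n r} (𝔹 : Incidence n r) where
  open Field 𝔽 hiding (zero)
  open Over 𝔽
  open MacroOver 𝔹
  open Macro 𝔹
  open MacroVertices 𝔹
  open FieldFacts 𝔽
  open RingProperties ring using ([y-z]x≈yx-zx)
  open import Relation.Binary.Reasoning.Setoid setoid

  coefficient : Fin r → Subset n → Carrier
  coefficient e w = ind (B e ≟S w) - ind (A e ≟S w)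

  ∑-select : ∀ {w} → InVmacro w → (f : Subset n → Carrier) →
             ∑ (λ j → ind (w ≟S vtx j) * f (vtx j)) ≈ f w
  ∑-select {w} w∈V f = begin
    ∑ (λ j → ind (w ≟S vtx j) * f (vtx j)) ≈⟨ ∑-delta i others≈0 ⟩
    ind (w ≟S vtx i) * f (vtx i)           ≈⟨ *-congʳ (ind-yes (w ≟S vtx i) w≡vtxᵢ) ⟩
    1# * f (vtx i)                         ≈⟨ *-identityˡ _ ⟩
    f (vtx i)                              ≡⟨ ≡.cong f (≡.sym w≡vtxᵢ) ⟩
    f w                                    ∎
    where
    w∈ = InVmacro⇒∈Vlist w∈V
    i = index w∈
    w≡vtxᵢ : w ≡ vtx i
    w≡vtxᵢ = lookup-index w∈
    others≈0 : ∀ j → j ≢ i → ind (w ≟S vtx j) * f (vtx j) ≈ 0#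
    others≈0 j j≢i = trans (*-congʳ (ind-no (w ≟S vtx j) w≢vtxⱼ)) (zeroˡ _)
      where w≢vtxⱼ = λ w≡vtxⱼ → j≢i (vtx-injective (≡.trans (≡.sym w≡vtxⱼ) w≡vtxᵢ))

  ∑-coefficient : ∀ e (f : Subset n → Carrier) →
                  ∑ (λ j → coefficient e (vtx j) * f (vtx j)) ≈ f (B e) - f (A e)
  ∑-coefficient e f = begin
    ∑ (λ j → coefficient e (vtx j) * f (vtx j))
      ≈⟨ ∑-cong (λ j → [y-z]x≈yx-zx (f (vtx j)) _ _) ⟩
    ∑ (λ j → ind (B e ≟S vtx j) * f (vtx j) - ind (A e ≟S vtx j) * f (vtx j))
      ≈⟨ ∑-distrib-- (λ j → ind (B e ≟S vtx j) * f (vtx j)) (λ j → ind (A e ≟S vtx j) * f (vtx j)) ⟩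
    ∑ (λ j → ind (B e ≟S vtx j) * f (vtx j)) - ∑ (λ j → ind (A e ≟S vtx j) * f (vtx j))
      ≈⟨ +-cong (∑-select (e , inj₂ ≡.refl) f) (-‿cong (∑-select (e , inj₁ ≡.refl) f)) ⟩
    f (B e) - f (A e)
      ∎

  φ̂-cong : ∀ {x y} → (∀ j → x j ≈ y j) → ∀ v → φ̂ x v ≈ φ̂ y v
  φ̂-cong x≈y v = ∑-cong (λ j → *-congʳ (x≈y j))

  φ̂∘Bmacro : ∀ γ v → φ̂ (Bmacro γ) v ≈ ∑ (λ e → γ e * (𝟏 (B e) v - 𝟏 (A e) v))
  φ̂∘Bmacro γ v = begin
    ∑ (λ j → ∑ (λ e → γ e * coefficient e (vtx j)) * 𝟏 (vtx j) v)
      ≈⟨ ∑-cong (λ j → *-distribʳ-∑ (𝟏 (vtx j) v) (λ e → γ e * coefficient e (vtx j))) ⟩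
    ∑ (λ j → ∑ (λ e → γ e * coefficient e (vtx j) * 𝟏 (vtx j) v))
      ≈⟨ ∑-comm (λ j e → γ e * coefficient e (vtx j) * 𝟏 (vtx j) v) ⟩
    ∑ (λ e → ∑ (λ j → γ e * coefficient e (vtx j) * 𝟏 (vtx j) v))
      ≈⟨ ∑-cong (λ e → trans (∑-cong (λ j → *-assoc (γ e) (coefficient e (vtx j)) (𝟏 (vtx j) v)))
                                (sym (*-distribˡ-∑ (γ e) (λ j → coefficient e (vtx j) * 𝟏 (vtx j) v)))) ⟩
    ∑ (λ e → γ e * ∑ (λ j → coefficient e (vtx j) * 𝟏 (vtx j) v))
      ≈⟨ ∑-cong (λ e → *-congˡ (∑-coefficient e (λ w → 𝟏 w v))) ⟩
    ∑ (λ e → γ e * (𝟏 (B e) v - 𝟏 (A e) v))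
      ∎

module Star {n r} (𝔹 : Incidence n r) (S : Subset n) (A≡S : ∀ e → srcSet 𝔹 e ≡ S)
            (B-injective : Injective _≡_ _≡_ (tgtSet 𝔹)) {v₀} (v₀∈S : vlookup S v₀ ≡ true) where
  open Macro 𝔹

  v₀∉B : ∀ e → vlookup (B e) v₀ ≡ false
  v₀∉B e = ∈srcSet⇒∉tgtSet 𝔹 e v₀ (≡.trans (≡.cong (λ T → vlookup T v₀) (A≡S e)) v₀∈S)

  B≢S : ∀ e → B e ≢ S
  B≢S e B≡S with ≡.trans (≡.sym (v₀∉B e)) (≡.trans (≡.cong (λ T → vlookup T v₀) B≡S) v₀∈S)
  ... | ()

  A≡w⇒w≡S : ∀ {e w} → A e ≡ w → w ≡ S
  A≡w⇒w≡S {e} A≡w = ≡.trans (≡.sym A≡w) (A≡S e)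

  isStar : Fin r → IsStar
  isStar e₀ = S , (e₀ , inj₁ (A≡S e₀)) , no-loop , (λ e → inj₁ (A≡S e)) , leaf
    where
    no-loop : ∀ e → A e ≢ B e
    no-loop e A≡B = B≢S e (A≡w⇒w≡S A≡B)
    leaf : ∀ w → InVmacro w → w ≢ S → ∃ λ e → Incident e w × (∀ e′ → Incident e′ w → e′ ≡ e)
    leaf w (e , inj₁ A≡w) w≢S = ⊥-elim (w≢S (A≡w⇒w≡S A≡w))
    leaf w (e , inj₂ B≡w) w≢S = e , inj₂ B≡w , only-e
      where
      only-e : ∀ e′ → Incident e′ w → e′ ≡ e
      only-e e′ (inj₁ A′≡w) = ⊥-elim (w≢S (A≡w⇒w≡S A′≡w))
      only-e e′ (inj₂ B′≡w) = B-injective (≡.trans B′≡w (≡.sym B≡w))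

  module Linear {c ℓ} (𝔽 : Field c ℓ) where
    open Field 𝔽 hiding (zero)
    open Over 𝔽
    open MacroOver 𝔹
    open MacroVertices 𝔹
    open MacroLinear 𝔽 𝔹
    open FieldFacts 𝔽
    open RingProperties ring using (x[y-z]≈xy-xz; x∙y⁻¹≈ε⇒x≈y; x≈y⇒x∙y⁻¹≈ε)
    open import Relation.Binary.Reasoning.Setoid setoid

    Bmacro-at-centre : ∀ γ {j} → ∑ γ ≈ 0# → vtx j ≡ S → Bmacro γ j ≈ 0#
    Bmacro-at-centre γ {j} ∑γ≈0 vtxⱼ≡S = begin
      ∑ (λ e → γ e * coefficient e (vtx j)) ≈⟨ ∑-cong (λ e → *-congˡ (coefficient-centre e)) ⟩
      ∑ (λ e → γ e * (0# - 1#))             ≈⟨ *-distribʳ-∑ (0# - 1#) γ ⟨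
      ∑ γ * (0# - 1#)                       ≈⟨ *-congʳ ∑γ≈0 ⟩
      0# * (0# - 1#)                        ≈⟨ zeroˡ _ ⟩
      0#                                    ∎
      where
      coefficient-centre : ∀ e → coefficient e (vtx j) ≈ 0# - 1#
      coefficient-centre e = +-cong (ind-no (B e ≟S vtx j) (B≢S e ∘ flip ≡.trans vtxⱼ≡S))
                                    (-‿cong (ind-yes (A e ≟S vtx j) (≡.trans (A≡S e) (≡.sym vtxⱼ≡S))))

    Bmacro-at-leaf : ∀ γ {j} e → vtx j ≡ B e → Bmacro γ j ≈ γ e
    Bmacro-at-leaf γ {j} e vtxⱼ≡B = begin
      ∑ (λ e′ → γ e′ * coefficient e′ (vtx j)) ≈⟨ ∑-delta e others≈0 ⟩
      γ e * coefficient e (vtx j)               ≈⟨ *-congˡ (+-cong indB≈1 -indA≈0) ⟩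
      γ e * (1# - 0#)                           ≈⟨ *-congˡ (x-0≈x 1#) ⟩
      γ e * 1#                                  ≈⟨ *-identityʳ (γ e) ⟩
      γ e                                       ∎
      where
      indB≈1 : ind (B e ≟S vtx j) ≈ 1#
      indB≈1 = ind-yes (B e ≟S vtx j) (≡.sym vtxⱼ≡B)
      -indA≈0 : ∀ {e′} → - ind (A e′ ≟S vtx j) ≈ - 0#
      -indA≈0 {e′} = -‿cong (ind-no (A e′ ≟S vtx j) (B≢S e ∘ A≡w⇒w≡S ∘ flip ≡.trans vtxⱼ≡B))
      others≈0 : ∀ e′ → e′ ≢ e → γ e′ * coefficient e′ (vtx j) ≈ 0#
      others≈0 e′ e′≢e = begin
        γ e′ * coefficient e′ (vtx j) ≈⟨ *-congˡ (+-cong (ind-no (B e′ ≟S vtx j) B′≢vtxⱼ) -indA≈0) ⟩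
        γ e′ * (0# - 0#)              ≈⟨ *-congˡ (x-0≈x 0#) ⟩
        γ e′ * 0#                     ≈⟨ zeroʳ (γ e′) ⟩
        0#                            ∎
        where B′≢vtxⱼ = e′≢e ∘ B-injective ∘ flip ≡.trans vtxⱼ≡B

    φ̂∘Bmacro-star : ∀ γ v → φ̂ (Bmacro γ) v ≈ ∑ (λ e → γ e * 𝟏 (B e) v) - ∑ γ * 𝟏 S v
    φ̂∘Bmacro-star γ v = begin
      φ̂ (Bmacro γ) v                          ≈⟨ φ̂∘Bmacro γ v ⟩
      ∑ (λ e → γ e * (𝟏 (B e) v - 𝟏 (A e) v)) ≈⟨ ∑-cong (λ e → reflexive (≡.cong (γ e *_) (𝟏B-𝟏A≡𝟏B-𝟏S e))) ⟩
      ∑ (λ e → γ e * (𝟏 (B e) v - 𝟏 S v))     ≈⟨ ∑-cong (λ e → x[y-z]≈xy-xz (γ e) (𝟏 (B e) v) (𝟏 S v)) ⟩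
      ∑ (λ e → γ e * 𝟏 (B e) v - γ e * 𝟏 S v) ≈⟨ ∑-distrib-- (λ e → γ e * 𝟏 (B e) v) (λ e → γ e * 𝟏 S v) ⟩
      ∑ (λ e → γ e * 𝟏 (B e) v) - ∑ (λ e → γ e * 𝟏 S v)
                                              ≈⟨ +-congˡ (-‿cong (*-distribʳ-∑ (𝟏 S v) γ)) ⟨
      ∑ (λ e → γ e * 𝟏 (B e) v) - ∑ γ * 𝟏 S v ∎
      where
      𝟏B-𝟏A≡𝟏B-𝟏S : ∀ e → 𝟏 (B e) v - 𝟏 (A e) v ≡ 𝟏 (B e) v - 𝟏 S v
      𝟏B-𝟏A≡𝟏B-𝟏S e = ≡.cong (λ T → 𝟏 (B e) v - 𝟏 T v) (A≡S e)

    ∑-leaves-at-v₀ : ∀ (γ : Fin r → Carrier) → ∑ (λ e → γ e * 𝟏 (B e) v₀) ≈ 0#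
    ∑-leaves-at-v₀ γ = ∑-zero (λ e → trans (*-congˡ (reflexive (≡.cong ⟦_⟧ (v₀∉B e)))) (zeroʳ (γ e)))

    δ>0⇒affinelyDependent : δ>0 → AffinelyDependent (λ e → 𝟏 (B e))
    δ>0⇒affinelyDependent (x , (γ , x≈Bγ) , φ̂x≈0 , j , xⱼ≉0) =
      γ , nontrivial (vtx-InVmacro j) , ∑γ≈0 , relation
      where
      balanced : ∀ v → ∑ (λ e → γ e * 𝟏 (B e) v) ≈ ∑ γ * 𝟏 S v
      balanced v = x∙y⁻¹≈ε⇒x≈y _ _ (begin
        ∑ (λ e → γ e * 𝟏 (B e) v) - ∑ γ * 𝟏 S v ≈⟨ φ̂∘Bmacro-star γ v ⟨
        φ̂ (Bmacro γ) v                          ≈⟨ φ̂-cong (sym ∘ x≈Bγ) v ⟩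
        φ̂ x v                                   ≈⟨ φ̂x≈0 v ⟩
        0#                                      ∎)
      ∑γ≈0 : ∑ γ ≈ 0#
      ∑γ≈0 = begin
        ∑ γ                        ≈⟨ *-identityʳ (∑ γ) ⟨
        ∑ γ * 1#                   ≡⟨ ≡.cong (λ b → ∑ γ * ⟦ b ⟧) v₀∈S ⟨
        ∑ γ * 𝟏 S v₀               ≈⟨ balanced v₀ ⟨
        ∑ (λ e → γ e * 𝟏 (B e) v₀) ≈⟨ ∑-leaves-at-v₀ γ ⟩
        0#                         ∎
      relation : ∀ v → ∑ (λ e → γ e * 𝟏 (B e) v) ≈ 0#
      relation v = trans (balanced v) (trans (*-congʳ ∑γ≈0) (zeroˡ (𝟏 S v)))
      nontrivial : InVmacro (vtx j) → ∃ λ e → ¬ (γ e ≈ 0#)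
      nontrivial (e , inj₁ A≡vtxⱼ) =
        ⊥-elim (xⱼ≉0 (trans (x≈Bγ j) (Bmacro-at-centre γ ∑γ≈0 (A≡w⇒w≡S A≡vtxⱼ))))
      nontrivial (e , inj₂ B≡vtxⱼ) =
        e , λ γₑ≈0 → xⱼ≉0 (trans (x≈Bγ j) (trans (Bmacro-at-leaf γ e (≡.sym B≡vtxⱼ)) γₑ≈0))

    affinelyDependent⇒δ>0 : AffinelyDependent (λ e → 𝟏 (B e)) → δ>0
    affinelyDependent⇒δ>0 (α , (e , αₑ≉0) , ∑α≈0 , relation) =
      Bmacro α , (α , λ _ → refl) , φ̂Bα≈0 , index Bₑ∈Vlist , Bα≉0
      where
      φ̂Bα≈0 : ∀ v → φ̂ (Bmacro α) v ≈ 0#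
      φ̂Bα≈0 v = trans (φ̂∘Bmacro-star α v)
                      (x≈y⇒x∙y⁻¹≈ε (trans (relation v) (sym (trans (*-congʳ ∑α≈0) (zeroˡ (𝟏 S v))))))
      Bₑ∈Vlist : B e ∈ Vlist
      Bₑ∈Vlist = InVmacro⇒∈Vlist (e , inj₂ ≡.refl)
      Bα≉0 : ¬ (Bmacro α (index Bₑ∈Vlist) ≈ 0#)
      Bα≉0 Bα≈0 = αₑ≉0 (trans (sym (Bmacro-at-leaf α e (≡.sym (lookup-index Bₑ∈Vlist)))) Bα≈0)

Isolated : ∀ {r} → (Fin r → Bool) → Fin r → Set
Isolated p i = ∀ l → l ≢ i → p l ≢ p i

odd-one-out : ∀ {r} → r ≤ 1 → (p : Fin (suc (suc r)) → Bool) → p zero ≢ p (suc zero) → ∃ (Isolated p)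
odd-one-out {zero} _ p p₀≢p₁ = zero , λ where
  zero       0≢0 → ⊥-elim (0≢0 ≡.refl)
  (suc zero) _   → p₀≢p₁ ∘ ≡.sym
odd-one-out {suc zero} _ p p₀≢p₁ with p (suc (suc zero)) ≟B p zero
... | yes p₂≡p₀ = suc zero , λ where
  zero             _   → p₀≢p₁
  (suc zero)       1≢1 → ⊥-elim (1≢1 ≡.refl)
  (suc (suc zero)) _   → p₀≢p₁ ∘ ≡.trans (≡.sym p₂≡p₀)
... | no p₂≢p₀ = zero , λ where
  zero             0≢0 → ⊥-elim (0≢0 ≡.refl)
  (suc zero)       _   → p₀≢p₁ ∘ ≡.sym
  (suc (suc zero)) _   → p₂≢p₀
odd-one-out {suc (suc _)} (s≤s ()) _ _

module AffineRelations {c ℓ} (𝔽 : Field c ℓ) where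
  open Field 𝔽 hiding (zero)
  open Over 𝔽
  open FieldFacts 𝔽
  open RingProperties ring using (x≈y⇒x∙y⁻¹≈ε)
  open import Relation.Binary.Reasoning.Setoid setoid

  ∑-isolated : ∀ {r} (α : Fin r → Carrier) {p i} → Isolated p i → p i ≡ true →
               ∑ (λ k → α k * ⟦ p k ⟧) ≈ α i
  ∑-isolated α {p} {i} isolated pᵢ≡true = begin
    ∑ (λ k → α k * ⟦ p k ⟧) ≈⟨ ∑-delta i others≈0 ⟩
    α i * ⟦ p i ⟧           ≡⟨ ≡.cong (λ b → α i * ⟦ b ⟧) pᵢ≡true ⟩
    α i * 1#                ≈⟨ *-identityʳ (α i) ⟩
    α i                     ∎
    where
    others≈0 : ∀ l → l ≢ i → α l * ⟦ p l ⟧ ≈ 0#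
    others≈0 l l≢i = trans (*-congˡ (reflexive (≡.cong ⟦_⟧ pₗ≡false))) (zeroʳ (α l))
      where pₗ≡false = ≡.trans (¬-not (isolated l l≢i)) (≡.cong not pᵢ≡true)

  isolated-coefficient-vanishes : ∀ {r} (α : Fin r → Carrier) {p i} →
    ∑ α ≈ 0# → ∑ (λ k → α k * ⟦ p k ⟧) ≈ 0# → Isolated p i → α i ≈ 0#
  isolated-coefficient-vanishes α {p} {i} ∑α≈0 ∑αp≈0 isolated with p i ≟B true
  ... | yes pᵢ≡true = trans (sym (∑-isolated α isolated pᵢ≡true)) ∑αp≈0
  ... | no  pᵢ≢true = trans (sym (∑-isolated α isolated-not (≡.cong not (¬-not pᵢ≢true)))) ∑αnotp≈0
    where
    isolated-not : Isolated (not ∘ p) i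
    isolated-not l l≢i = isolated l l≢i ∘ not-injective
    ∑αnotp≈0 : ∑ (λ k → α k * ⟦ not (p k) ⟧) ≈ 0#
    ∑αnotp≈0 = begin
      ∑ (λ k → α k * ⟦ not (p k) ⟧) ≈⟨ ∑-cong (λ k → *⟦not⟧ (α k) (p k)) ⟩
      ∑ (λ k → α k - α k * ⟦ p k ⟧) ≈⟨ ∑-distrib-- α (λ k → α k * ⟦ p k ⟧) ⟩
      ∑ α - ∑ (λ k → α k * ⟦ p k ⟧) ≈⟨ x≈y⇒x∙y⁻¹≈ε (trans ∑α≈0 (sym ∑αp≈0)) ⟩
      0#                            ∎

  affine-relation-trivial : ∀ {n r} → r ≤ 3 → (H : Fin r → Subset n) → Injective _≡_ _≡_ H →
    (α : Fin r → Carrier) → ∑ α ≈ 0# → (∀ v → ∑ (λ i → α i * 𝟏 (H i) v) ≈ 0#) → ∀ i → α i ≈ 0#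
  affine-relation-trivial {r = suc zero} _ _ _ α ∑α≈0 _ zero = trans (sym (+-identityʳ (α zero))) ∑α≈0
  affine-relation-trivial {r = suc (suc r)} 2+r≤3 H H-injective α ∑α≈0 relation =
    ∀-punchIn m αₘ≈0
      (affine-relation-trivial (<⇒≤ 2+r≤3) (removeAt H m) (punchIn-injective m _ _ ∘ H-injective)
                               (removeAt α m) (trans (∑-removeAt m α αₘ≈0) ∑α≈0) relation-without-m)
    where
    separated = separating-coordinate {u = H zero} {H (suc zero)} (0≢1+n ∘ H-injective)
    v = proj₁ separated
    isolating = odd-one-out (s≤s⁻¹ (s≤s⁻¹ 2+r≤3)) (λ k → vlookup (H k) v) (proj₂ separated)
    m = proj₁ isolating
    αₘ≈0 : α m ≈ 0#
    αₘ≈0 = isolated-coefficient-vanishes α ∑α≈0 (relation v) (proj₂ isolating)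
    relation-without-m : ∀ v → ∑ (λ k → α (punchIn m k) * 𝟏 (H (punchIn m k)) v) ≈ 0#
    relation-without-m v =
      trans (∑-removeAt m (λ i → α i * 𝟏 (H i) v) (trans (*-congʳ αₘ≈0) (zeroˡ _))) (relation v)

  affinelyDependent⇒4≤r : ∀ {n r} (H : Fin r → Subset n) → Injective _≡_ _≡_ H →
                          AffinelyDependent (λ i → 𝟏 (H i)) → 4 ≤ r
  affinelyDependent⇒4≤r {r = r} H H-injective (α , (i , αᵢ≉0) , ∑α≈0 , relation) with r ≤? 3
  ... | yes r≤3 = ⊥-elim (αᵢ≉0 (affine-relation-trivial r≤3 H H-injective α ∑α≈0 relation i))
  ... | no  r≰3 = ≰⇒> r≰3

proposition7p9 : ∀ {c ℓ : Level} (𝔽 : Field c ℓ) (n r : ℕ) (𝔹 : Incidence n r)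
    → 1 ≤ r
    → (S : Subset n) → Nonempty S
    → (∀ e → srcSet 𝔹 e ≡ S)
    → (∀ i j → tgtSet 𝔹 i ≡ tgtSet 𝔹 j → i ≡ j)
    → Macro.IsStar 𝔹
      × (Over.MacroOver.δ>0 𝔽 𝔹 ⇔ Over.AffinelyDependent 𝔽 (λ i → Over.𝟏 𝔽 (tgtSet 𝔹 i)))
      × (Over.MacroOver.δ>0 𝔽 𝔹 → 4 ≤ r)
proposition7p9 𝔽 n r 𝔹 1≤r S (v₀ , v₀∈S) A≡S B-injective =
    isStar (fromℕ< 1≤r)
  , mk⇔ δ>0⇒affinelyDependent affinelyDependent⇒δ>0
  , affinelyDependent⇒4≤r (tgtSet 𝔹) (B-injective _ _) ∘ δ>0⇒affinelyDependent
  where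
  open Star 𝔹 S A≡S (B-injective _ _) ([]=⇒lookup v₀∈S)
  open Linear 𝔽
  open AffineRelations 𝔽
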